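{- Fix integers $d,m,n\geq 2$, a proper divisor $\ell\geq1$ of $n$, and a $d$-th root of unity $\zeta\neq1$. Define $C_{d,m,\ell}=d^{\ell}\big(\prod_{i=0}^{\ell-1}a_{m-1+i}\big)^{d-1}\in\mathbb{Z}[c]$. Then for every integer $j\geq1$, $$b_{j+1}\equiv \zeta^{d-1}C_{d,m,\ell}\,b_j+1\pmod{I},$$ where $I=\langle B_1\rangle$ is the principal ideal of $\mathbb{Z}[\zeta,c]$ generated by $B_1=a_{m+\ell-1}-\zeta a_{m-1}$. In particular, for any root $\alpha_0$ of $B_1$, $b_{j+1}(\alpha_0)=\zeta^{d-1}C_{d,m,\ell}(\alpha_0)b_j(\alpha_0)+1$.
   Context: For an integer $d\geq 2$ define polynomials $a_i\in\mathbb{Z}[c]$ by $a_1=c$, $a_{i+1}=a_i^d+c$, with $a_0=0$. For the fixed $m,\ell,\zeta$, set $B_j=a_{m+\ell j-1}-\zeta a_{m-1}\in\mathbb{Z}[\zeta,c]$ for $j\geq1$ and $b_j=B_j/B_1$; each $b_j$ is a polynomial in $\mathbb{Z}[\zeta,c]$. -}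

module Defs where

open import Level using (Level)
open import Algebra.Bundles using (CommutativeRing)
open import Data.Nat using (ℕ; zero; suc) renaming (_+_ to _+ℕ_; _*_ to _*ℕ_; _∸_ to _∸ℕ_)

-- Everything is interpreted inside a commutative ring R, which plays the
-- role of Z[ζ,c] (the image of the integer polynomials under the canonical
-- map Z[c] → R, c ↦ c).
module Dyn {r₁ r₂ : Level} (R : CommutativeRing r₁ r₂) where
  open CommutativeRing R

  pow : Carrier → ℕ → Carrier
  pow x zero    = 1#
  pow x (suc k) = x * pow x k

  natR : ℕ → Carrier
  natR zero    = 0#
  natR (suc k) = 1# + natR k

  a : (d : ℕ) (c : Carrier) → ℕ → Carrier
  a d c zero    = 0#
  a d c (suc i) = pow (a d c i) d + c

  prod : ℕ → (ℕ → Carrier) → Carrier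
  prod zero    f = 1#
  prod (suc k) f = prod k f * f k

  B : (d m l : ℕ) (ζ c : Carrier) → ℕ → Carrier
  B d m l ζ c j = a d c (m +ℕ l *ℕ j ∸ℕ 1) - ζ * a d c (m ∸ℕ 1)

  Cdml : (d m l : ℕ) (c : Carrier) → Carrier
  Cdml d m l c = pow (natR d) l * pow (prod l (λ i → a d c (m ∸ℕ 1 +ℕ i))) (d ∸ℕ 1)

{-# OPTIONS --safe #-}
-- Put β = B₁, f(x) = xᵈ + c and N = m - 1 + ℓj, so that a_{N+t} = fᵗ(a_N) and, by hypothesis,
-- a_N = ζ a_{m-1} + β b_j. Expanding to first order modulo β²,
--   a_{N+ℓ} ≡ f^ℓ(ζ a_{m-1}) + β (f^ℓ)′(ζ a_{m-1}) b_j.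
-- Since ζᵈ = 1 we have f(ζx) = f(x), so f^ℓ(ζ a_{m-1}) = a_{m-1+ℓ} = β + ζ a_{m-1}, and by the
-- chain rule (f^ℓ)′(ζ a_{m-1}) = ζ^{d-1} d^ℓ ∏ a_{m-1+i}^{d-1} = ζ^{d-1} C. Hence
-- β b_{j+1} = B_{j+1} ≡ β (ζ^{d-1} C b_j + 1) modulo β², and cancelling β gives the congruence
-- modulo β; a ring homomorphism killing β turns it into an equality.
module Submission where

open import Defs
open import Level using (Level; _⊔_)
open import Algebra.Bundles using (CommutativeRing)
open import Algebra.Morphism.Structures using (module RingMorphisms)
open import Data.Nat using (ℕ; zero; suc; _≤_; _<_) renaming (_+_ to _+ℕ_; _*_ to _*ℕ_; _∸_ to _∸ℕ_)
open import Data.Nat.Divisibility using (_∣_)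
open import Data.Nat.GeneralisedArithmetic using (fold)
import Data.Nat.Properties as ℕₚ
open import Data.Nat.Tactic.RingSolver using (solve-∀)
open import Data.Product using (_×_; ∃; _,_)
import Relation.Binary.PropositionalEquality as ≡
open import Relation.Nullary using (¬_)

module Congruence {r₁ r₂ : Level} (R : CommutativeRing r₁ r₂) where
  open CommutativeRing R
  open import Algebra.Properties.Group +-group using (//-rightDividesʳ)

  infix 4 _≡_[mod_]
  _≡_[mod_] : Carrier → Carrier → Carrier → Set (r₁ ⊔ r₂)
  x ≡ y [mod e ] = ∃ λ q → x ≈ y + e * q

  ≈⇒≡[mod] : ∀ {x y e} → x ≈ y → x ≡ y [mod e ]
  ≈⇒≡[mod] {y = y} {e} x≈y = 0# , trans x≈y (sym (trans (+-congˡ (zeroʳ e)) (+-identityʳ y)))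

  ≡[mod]-respˡ : ∀ {x x′ y e} → x ≈ x′ → x ≡ y [mod e ] → x′ ≡ y [mod e ]
  ≡[mod]-respˡ x≈x′ (q , x≈y+eq) = q , trans (sym x≈x′) x≈y+eq

  ≡[mod]-respʳ : ∀ {x y y′ e} → y ≈ y′ → x ≡ y [mod e ] → x ≡ y′ [mod e ]
  ≡[mod]-respʳ y≈y′ (q , x≈y+eq) = q , trans x≈y+eq (+-congʳ y≈y′)

  ≡[mod]-subtract : ∀ {x y z e} → x ≡ y + z [mod e ] → x - z ≡ y [mod e ]
  ≡[mod]-subtract {y = y} {z} {e} (q , x≈y+z+eq) =
    q , trans (+-congʳ (trans x≈y+z+eq (swap y z (e * q)))) (//-rightDividesʳ z (y + e * q))
    where
    open import Algebra.Solver.Ring.NaturalCoefficients.Default commutativeSemiring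
    swap : ∀ y z w → y + z + w ≈ y + w + z
    swap = solve 3 (λ y z w → y :+ z :+ w := y :+ w :+ z) refl

  ≡[mod]⇒x-y≈e*q : ∀ {x y e} → x ≡ y [mod e ] → ∃ λ q → x - y ≈ e * q
  ≡[mod]⇒x-y≈e*q {y = y} {e} (q , x≈y+eq) =
    q , trans (+-congʳ (trans x≈y+eq (+-comm y (e * q)))) (//-rightDividesʳ y (e * q))

  ≡[mod]-cancel : ∀ {e x y} → (∀ u v → e * u ≈ e * v → u ≈ v) →
                  e * x ≡ e * y [mod e * e ] → x ≡ y [mod e ]
  ≡[mod]-cancel {e} {x} {y} cancel (q , ex≈ey+eeq) = q , cancel x (y + e * q) (begin
    e * x                   ≈⟨ ex≈ey+eeq ⟩
    e * y + e * e * q       ≈⟨ +-congˡ (*-assoc e e q) ⟩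
    e * y + e * (e * q)     ≈⟨ distribˡ e y (e * q) ⟨
    e * (y + e * q)         ∎)
    where open import Relation.Binary.Reasoning.Setoid setoid

module _ {r₁ r₂ s₁ s₂ : Level} (R : CommutativeRing r₁ r₂) (S : CommutativeRing s₁ s₂) where
  private
    module R = CommutativeRing R
    module S = CommutativeRing S
  open Congruence R
  open RingMorphisms R.rawRing S.rawRing

  ≡[mod]-image : ∀ {φ x y e} → IsRingHomomorphism φ → S._≈_ (φ e) S.0# →
                 x ≡ y [mod e ] → S._≈_ (φ x) (φ y)
  ≡[mod]-image {φ} {x} {y} {e} hom φe≈0 (q , x≈y+eq) = begin
    φ x                   ≈⟨ ⟦⟧-cong x≈y+eq ⟩
    φ (y R.+ e R.* q)     ≈⟨ S.trans (+-homo y (e R.* q)) (S.+-congˡ (*-homo e q)) ⟩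
    φ y S.+ φ e S.* φ q   ≈⟨ S.+-congˡ (S.trans (S.*-congʳ φe≈0) (S.zeroˡ (φ q))) ⟩
    φ y S.+ S.0#          ≈⟨ S.+-identityʳ (φ y) ⟩
    φ y                   ∎
    where
    open IsRingHomomorphism hom
    open import Relation.Binary.Reasoning.Setoid S.setoid

  homo-affine : ∀ {φ} → IsRingHomomorphism φ → ∀ x y z →
                S._≈_ (φ (x R.* y R.* z R.+ R.1#)) (φ x S.* φ y S.* φ z S.+ S.1#)
  homo-affine {φ} hom x y z = S.trans (+-homo _ R.1#)
    (S.+-cong (S.trans (*-homo (x R.* y) z) (S.*-congʳ (*-homo x y))) 1#-homo)
    where open IsRingHomomorphism hom

module Powers {r₁ r₂ : Level} (R : CommutativeRing r₁ r₂) where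
  open CommutativeRing R
  open Dyn R
  open import Algebra.Properties.CommutativeSemiring.Exp commutativeSemiring
    using (_^_; ^-congˡ; ^-distrib-*)

  pow≈^ : ∀ x n → pow x n ≈ x ^ n
  pow≈^ x zero    = refl
  pow≈^ x (suc n) = *-congˡ (pow≈^ x n)

  pow-cong : ∀ {x y} n → x ≈ y → pow x n ≈ pow y n
  pow-cong {x} {y} n x≈y = trans (pow≈^ x n) (trans (^-congˡ n x≈y) (sym (pow≈^ y n)))

  pow-distrib-* : ∀ x y n → pow (x * y) n ≈ pow x n * pow y n
  pow-distrib-* x y n = trans (pow≈^ (x * y) n)
    (trans (^-distrib-* x y n) (sym (*-cong (pow≈^ x n) (pow≈^ y n))))

  pow-1# : ∀ n → pow 1# n ≈ 1#
  pow-1# zero    = refl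
  pow-1# (suc n) = trans (*-identityˡ (pow 1# n)) (pow-1# n)

  prod-cong : ∀ {f g} t → (∀ i → f i ≈ g i) → prod t f ≈ prod t g
  prod-cong zero    f≈g = refl
  prod-cong (suc t) f≈g = *-cong (prod-cong t f≈g) (f≈g t)

  prod-scale-pow : ∀ u k g t → prod t (λ i → u * pow (g i) k) ≈ pow u t * pow (prod t g) k
  prod-scale-pow u k g zero    = sym (trans (*-identityˡ (pow 1# k)) (pow-1# k))
  prod-scale-pow u k g (suc t) = begin
    prod t (λ i → u * pow (g i) k) * (u * pow (g t) k)  ≈⟨ *-congʳ (prod-scale-pow u k g t) ⟩
    (pow u t * pow P k) * (u * pow (g t) k)            ≈⟨ rearrange (pow u t) (pow P k) u (pow (g t) k) ⟩
    (u * pow u t) * (pow P k * pow (g t) k)            ≈⟨ *-congˡ (pow-distrib-* P (g t) k) ⟨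
    (u * pow u t) * pow (P * g t) k                    ∎
    where
    P = prod t g
    open import Relation.Binary.Reasoning.Setoid setoid
    open import Algebra.Solver.Ring.NaturalCoefficients.Default commutativeSemiring
    rearrange : ∀ a b u v → (a * b) * (u * v) ≈ (u * a) * (b * v)
    rearrange = solve 4 (λ a b u v → (a :* b) :* (u :* v) := (u :* a) :* (b :* v)) refl

module Linearisation {r₁ r₂ : Level} (R : CommutativeRing r₁ r₂) where
  open CommutativeRing R
  open Dyn R
  open Congruence R
  open import Algebra.Solver.Ring.NaturalCoefficients.Default commutativeSemiring
  open import Relation.Binary.Reasoning.Setoid setoid

  pow-suc-linear : ∀ n x e w →
    pow (x + e * w) (suc n) ≡ pow x (suc n) + e * (natR (suc n) * pow x n * w) [mod e * e ]
  pow-suc-linear zero x e w = 0# ,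
    solve 3 (λ x e w → (x :+ e :* w) :* con 1
                     := x :* con 1 :+ e :* ((con 1 :+ con 0) :* con 1 :* w) :+ e :* e :* con 0) refl x e w
  pow-suc-linear (suc n) x e w with pow-suc-linear n x e w
  ... | q , h = x * q + N * p * w * w + e * w * q , (begin
    (x + e * w) * pow (x + e * w) (suc n)                ≈⟨ *-congˡ h ⟩
    (x + e * w) * (x * p + e * (N * p * w) + e * e * q)  ≈⟨ expand x e w p N q ⟩
    x * (x * p) + e * ((1# + N) * (x * p) * w) + e * e * (x * q + N * p * w * w + e * w * q) ∎)
    where
    p = pow x n
    N = natR (suc n)
    expand : ∀ x e w p N q →
      (x + e * w) * (x * p + e * (N * p * w) + e * e * q)
        ≈ x * (x * p) + e * ((1# + N) * (x * p) * w) + e * e * (x * q + N * p * w * w + e * w * q)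
    expand = solve 6 (λ x e w p N q →
      (x :+ e :* w) :* (x :* p :+ e :* (N :* p :* w) :+ e :* e :* q)
        := x :* (x :* p) :+ e :* ((con 1 :+ N) :* (x :* p) :* w) :+ e :* e :* (x :* q :+ N :* p :* w :* w :+ e :* w :* q)) refl

module Dynamics {r₁ r₂ : Level} (R : CommutativeRing r₁ r₂) (k : ℕ) (c : CommutativeRing.Carrier R) where
  open CommutativeRing R
  open Dyn R
  open Congruence R
  open Powers R
  open Linearisation R
  open ≡ using (_≡_)
  open import Algebra.Solver.Ring.NaturalCoefficients.Default commutativeSemiring
  open import Relation.Binary.Reasoning.Setoid setoid

  f : Carrier → Carrier
  f x = pow x (suc k) + c

  f′ : Carrier → Carrier
  f′ x = natR (suc k) * pow x k

  orbit : Carrier → ℕ → Carrier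
  orbit x t = fold x f t

  -- (fᵗ)′(x), by the chain rule
  orbit′ : Carrier → ℕ → Carrier
  orbit′ x t = prod t (λ i → f′ (orbit x i))

  a≡orbit : ∀ t i → a (suc k) c (t +ℕ i) ≡ orbit (a (suc k) c i) t
  a≡orbit zero    i = ≡.refl
  a≡orbit (suc t) i = ≡.cong f (a≡orbit t i)

  f-cong : ∀ {x y} → x ≈ y → f x ≈ f y
  f-cong x≈y = +-congʳ (pow-cong (suc k) x≈y)

  f-linear : ∀ {x y e w} → y ≡ x + e * w [mod e * e ] → f y ≡ f x + e * (f′ x * w) [mod e * e ]
  f-linear {x} {y} {e} {w} (s , y≈x+ew+ees) with pow-suc-linear k x e (w + e * s)
  ... | q , h = f′ x * s + q , (begin
    pow y (suc k) + c                                          ≈⟨ +-congʳ (pow-cong (suc k) y≈x+e[w+es]) ⟩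
    pow (x + e * (w + e * s)) (suc k) + c                      ≈⟨ +-congʳ h ⟩
    pow x (suc k) + e * (f′ x * (w + e * s)) + e * e * q + c  ≈⟨ regroup (pow x (suc k)) c e (f′ x) w s q ⟩
    pow x (suc k) + c + e * (f′ x * w) + e * e * (f′ x * s + q) ∎)
    where
    y≈x+e[w+es] : y ≈ x + e * (w + e * s)
    y≈x+e[w+es] = trans y≈x+ew+ees
      (solve 4 (λ x e w s → x :+ e :* w :+ e :* e :* s := x :+ e :* (w :+ e :* s)) refl x e w s)
    regroup : ∀ X c e D w s q →
      X + e * (D * (w + e * s)) + e * e * q + c ≈ X + c + e * (D * w) + e * e * (D * s + q)
    regroup = solve 7 (λ X c e D w s q →
      X :+ e :* (D :* (w :+ e :* s)) :+ e :* e :* q :+ c := X :+ c :+ e :* (D :* w) :+ e :* e :* (D :* s :+ q)) refl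

  orbit-linear : ∀ t {x y e w} → y ≡ x + e * w [mod e * e ] →
                 orbit y t ≡ orbit x t + e * (orbit′ x t * w) [mod e * e ]
  orbit-linear zero    {w = w} y≡x+ew =
    ≡[mod]-respʳ (+-congˡ (*-congˡ (sym (*-identityˡ w)))) y≡x+ew
  orbit-linear (suc t) {x} {w = w} y≡x+ew =
    ≡[mod]-respʳ (+-congˡ (*-congˡ (chain (f′ (orbit x t)) (orbit′ x t) w)))
      (f-linear (orbit-linear t y≡x+ew))
    where
    chain : ∀ F D w → F * (D * w) ≈ D * F * w
    chain = solve 3 (λ F D w → F :* (D :* w) := D :* F :* w) refl

  module _ {ζ : Carrier} (ζᵈ≈1 : pow ζ (suc k) ≈ 1#) where

    f-rotate : ∀ x → f (ζ * x) ≈ f x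
    f-rotate x = +-congʳ (begin
      pow (ζ * x) (suc k)            ≈⟨ pow-distrib-* ζ x (suc k) ⟩
      pow ζ (suc k) * pow x (suc k)  ≈⟨ *-congʳ ζᵈ≈1 ⟩
      1# * pow x (suc k)             ≈⟨ *-identityˡ (pow x (suc k)) ⟩
      pow x (suc k)                  ∎)

    orbit-rotate : ∀ x t → orbit (ζ * x) (suc t) ≈ orbit x (suc t)
    orbit-rotate x zero    = f-rotate x
    orbit-rotate x (suc t) = f-cong (orbit-rotate x t)

    orbit′-rotate : ∀ x t → orbit′ (ζ * x) (suc t) ≈ pow ζ k * orbit′ x (suc t)
    orbit′-rotate x zero = begin
      1# * (natR (suc k) * pow (ζ * x) k)        ≈⟨ *-congˡ (*-congˡ (pow-distrib-* ζ x k)) ⟩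
      1# * (natR (suc k) * (pow ζ k * pow x k))  ≈⟨ swap (natR (suc k)) (pow ζ k) (pow x k) ⟩
      pow ζ k * (1# * (natR (suc k) * pow x k))  ∎
      where
      swap : ∀ n z p → 1# * (n * (z * p)) ≈ z * (1# * (n * p))
      swap = solve 3 (λ n z p → con 1 :* (n :* (z :* p)) := z :* (con 1 :* (n :* p))) refl
    orbit′-rotate x (suc t) = begin
      orbit′ (ζ * x) (suc t) * f′ (orbit (ζ * x) (suc t))  ≈⟨ *-cong (orbit′-rotate x t)
                                                              (*-congˡ (pow-cong k (orbit-rotate x t))) ⟩
      pow ζ k * orbit′ x (suc t) * f′ (orbit x (suc t))    ≈⟨ *-assoc (pow ζ k) _ _ ⟩
      pow ζ k * orbit′ x (suc (suc t))                      ∎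

module Recurrence {r₁ r₂ : Level} (R : CommutativeRing r₁ r₂) (k M l′ : ℕ)
                  {ζ c : CommutativeRing.Carrier R} (ζᵈ≈1 : CommutativeRing._≈_ R (Dyn.pow R ζ (suc k)) (CommutativeRing.1# R)) where
  open CommutativeRing R
  open Dyn R
  open Congruence R
  open Powers R
  open Dynamics R k c
  open ≡ using (_≡_)
  open import Algebra.Properties.Group +-group using (//-rightDividesˡ; //-rightDividesʳ)
  open import Algebra.Solver.Ring.NaturalCoefficients.Default commutativeSemiring
  open import Relation.Binary.Reasoning.Setoid setoid

  private
    L = suc l′
    A = a (suc k) c M
    β = B (suc k) (suc M) L ζ c 1
    C = Cdml (suc k) (suc M) L c

  C≈orbit′ : C ≈ orbit′ A L
  C≈orbit′ = sym (trans (prod-scale-pow (natR (suc k)) k (orbit A) L)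
    (*-congˡ (pow-cong k (prod-cong L λ i →
      reflexive (≡.sym (≡.trans (≡.cong (a (suc k) c) (ℕₚ.+-comm M i)) (a≡orbit i M)))))))

  orbit≈β+ζA : orbit A L ≈ β + ζ * A
  orbit≈β+ζA = begin
    orbit A L                      ≡⟨ ≡.sym (a≡orbit L M) ⟩
    a (suc k) c (L +ℕ M)           ≡⟨ ≡.cong (a (suc k) c) (index L M) ⟩
    a (suc k) c (M +ℕ L *ℕ 1)      ≈⟨ //-rightDividesˡ (ζ * A) _ ⟨
    β + ζ * A                      ∎
    where
    index : ∀ L M → L +ℕ M ≡ M +ℕ L *ℕ 1
    index = solve-∀

  B-suc : ∀ j {u} → B (suc k) (suc M) L ζ c j ≈ β * u →
          B (suc k) (suc M) L ζ c (j +ℕ 1) ≡ β * (pow ζ k * C * u + 1#) [mod β * β ]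
  B-suc j {u} Bⱼ≈βu = ≡[mod]-subtract (≡[mod]-respˡ orbit≈aₙ₊ₗ (≡[mod]-respʳ linear-part
    (orbit-linear L (≈⇒≡[mod] aₙ≈ζA+βu))))
    where
    N = M +ℕ L *ℕ j
    index : ∀ M L j → L +ℕ (M +ℕ L *ℕ j) ≡ M +ℕ L *ℕ (j +ℕ 1)
    index = solve-∀
    orbit≈aₙ₊ₗ : orbit (a (suc k) c N) L ≈ a (suc k) c (M +ℕ L *ℕ (j +ℕ 1))
    orbit≈aₙ₊ₗ = reflexive (≡.trans (≡.sym (a≡orbit L N)) (≡.cong (a (suc k) c) (index M L j)))
    aₙ≈ζA+βu : a (suc k) c N ≈ ζ * A + β * u
    aₙ≈ζA+βu = trans (sym (//-rightDividesˡ (ζ * A) _)) (trans (+-congʳ Bⱼ≈βu) (+-comm _ _))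
    regroup : ∀ β Z V → β + Z + β * V ≈ β * (V + 1#) + Z
    regroup = solve 3 (λ β Z V → β :+ Z :+ β :* V := β :* (V :+ con 1) :+ Z) refl
    linear-part : orbit (ζ * A) L + β * (orbit′ (ζ * A) L * u) ≈ β * (pow ζ k * C * u + 1#) + ζ * A
    linear-part = begin
      orbit (ζ * A) L + β * (orbit′ (ζ * A) L * u)  ≈⟨ +-cong (orbit-rotate ζᵈ≈1 A l′)
                                                          (*-congˡ (*-congʳ (orbit′-rotate ζᵈ≈1 A l′))) ⟩
      orbit A L + β * (pow ζ k * orbit′ A L * u)      ≈⟨ +-cong orbit≈β+ζA (*-congˡ (*-congʳ (*-congˡ (sym C≈orbit′)))) ⟩
      β + ζ * A + β * (pow ζ k * C * u)              ≈⟨ regroup β (ζ * A) (pow ζ k * C * u) ⟩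
      β * (pow ζ k * C * u + 1#) + ζ * A            ∎

theorem4p1 : {r₁ r₂ s₁ s₂ : Level} (R : CommutativeRing r₁ r₂)
  → let open CommutativeRing R
        open Dyn R
    in (d m n l : ℕ) → 2 ≤ d → 2 ≤ m → 2 ≤ n → 1 ≤ l → l ∣ n → l < n
    → (ζ c : Carrier) → pow ζ d ≈ 1# → ¬ (ζ ≈ 1#)
    → (∀ x y → B d m l ζ c 1 * x ≈ B d m l ζ c 1 * y → x ≈ y)
    → (b : ℕ → Carrier) → (∀ j → 1 ≤ j → B d m l ζ c j ≈ B d m l ζ c 1 * b j)
    → (∀ j → 1 ≤ j → ∃ λ q →
          b (j +ℕ 1) - (pow ζ (d ∸ℕ 1) * Cdml d m l c * b j + 1#)
            ≈ B d m l ζ c 1 * q)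
      × ((S : CommutativeRing s₁ s₂) (φ : Carrier → CommutativeRing.Carrier S)
          → RingMorphisms.IsRingHomomorphism rawRing (CommutativeRing.rawRing S) φ
          → CommutativeRing._≈_ S (φ (B d m l ζ c 1)) (CommutativeRing.0# S)
          → ∀ j → 1 ≤ j
          → CommutativeRing._≈_ S (φ (b (j +ℕ 1)))
              (CommutativeRing._+_ S
                (CommutativeRing._*_ S
                  (CommutativeRing._*_ S (φ (pow ζ (d ∸ℕ 1))) (φ (Cdml d m l c)))
                  (φ (b j)))
                (CommutativeRing.1# S)))
theorem4p1 R zero    m       n l       () _  _ _  _ _ _ _ _ _ _ _ _
theorem4p1 R (suc k) zero    n l       _  () _ _  _ _ _ _ _ _ _ _ _
theorem4p1 R (suc k) (suc M) n zero    _  _  _ () _ _ _ _ _ _ _ _ _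
theorem4p1 R (suc k) (suc M) n (suc l′) _ _ _ _ _ _ ζ c ζᵈ≈1 _ cancel b Bⱼ≈βbⱼ =
  (λ j 1≤j → ≡[mod]⇒x-y≈e*q (b-recurrence j 1≤j)) ,
  (λ S φ hom φβ≈0 j 1≤j → CommutativeRing.trans S
    (≡[mod]-image R S hom φβ≈0 (b-recurrence j 1≤j)) (homo-affine R S hom _ _ (b j)))
  where
  open CommutativeRing R
  open Dyn R
  open Congruence R
  b-recurrence : ∀ j → 1 ≤ j →
    b (j +ℕ 1) ≡ pow ζ k * Cdml (suc k) (suc M) (suc l′) c * b j + 1# [mod B (suc k) (suc M) (suc l′) ζ c 1 ]
  b-recurrence j 1≤j = ≡[mod]-cancel cancel
    (≡[mod]-respˡ (Bⱼ≈βbⱼ (j +ℕ 1) (ℕₚ.m≤n+m 1 j)) (Recurrence.B-suc R k M l′ ζᵈ≈1 j (Bⱼ≈βbⱼ j 1≤j)))
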